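{- Let $f(n)=n^2+bn+c$ with $b,c\in\mathbb{Z}$ be irreducible over $\mathbb{Q}$, let $x$ be a positive integer and $p$ a prime such that $p^2$ divides $\prod_{n=1}^{x}f(n)$. Then $p<(2+|b|+|c|)x$. -}

module Defs where

open import Data.Nat as ℕ using (ℕ; zero; suc)
open import Data.Integer as ℤ using (ℤ; +_)
import Data.Rational as ℚ
open import Data.Rational using (ℚ; _/_)
open import Data.Product using (∃-syntax; _×_)
open import Relation.Binary.PropositionalEquality using (_≡_; _≢_)
open import Relation.Nullary using (¬_)

quadEval : ℤ → ℤ → ℤ → ℤ
quadEval b c n = n ℤ.* n ℤ.+ b ℤ.* n ℤ.+ c

quadProd : ℤ → ℤ → ℕ → ℤ
quadProd b c zero    = + 1
quadProd b c (suc x) = quadProd b c x ℤ.* quadEval b c (+ suc x)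

-- The polynomial X² + bX + c ∈ ℚ[X] is irreducible over ℚ: it is not a
-- product of two non-constant polynomials over ℚ.  Since it has degree 2,
-- a non-trivial factorisation is (a₁X + a₀)(d₁X + d₀) with a₁, d₁ ≠ 0;
-- comparing coefficients of X², X, 1 gives the equations below.
IrreducibleQuad : ℤ → ℤ → Set
IrreducibleQuad b c =
  ¬ (∃[ a₁ ] ∃[ a₀ ] ∃[ d₁ ] ∃[ d₀ ]
       (a₁ ≢ ℚ.0ℚ × d₁ ≢ ℚ.0ℚ
       × a₁ ℚ.* d₁ ≡ ℚ.1ℚ
       × a₁ ℚ.* d₀ ℚ.+ a₀ ℚ.* d₁ ≡ b / 1
       × a₀ ℚ.* d₀ ≡ c / 1))

module Submission where

-- Write f(n) = n² + bn + c, K = |b|, C = |c| and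
-- B = (2 + K + C)·x.  Irreducibility is used only through its consequence
-- that f has no integer root (a root r would give the factorisation
-- (X − r)(X + r + b)); in particular f(n) ≠ 0 for every n and C ≥ 1.
-- If p² divides |∏_{n=1}^{x} f(n)| = ∏_{n=1}^{x} |f(n)|, then either
--   (1) p² | f(n) for some n ≤ x; then p² ≤ |f(n)| ≤ x² + Kx + C < B², or
--   (2) p | f(n) and p | f(m) for some n < m ≤ x; then p divides
--       f(m) − f(n) = (m − n)(m + n + b), so p ≤ m − n < B, or
--       p ≤ |m + n + b| ≤ 2x + K < B, or m + n + b = 0, in which case
--       K = m + n, f(n) = c − nm and p ≤ |f(n)| ≤ C + Kx < B.

open import Defs
open import Data.Nat using (ℕ; _<_; _≤_; _+_; _*_; _^_)
open import Data.Integer using (ℤ; ∣_∣; +_)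
open import Data.Integer.Divisibility using (_∣_)
open import Data.Nat.Primality using (Prime)

open import Data.Nat as ℕ using (zero; suc; _∸_; z≤n; s≤s)
import Data.Nat.Properties as ℕP
import Data.Nat.Divisibility as ℕD
open import Data.Nat.Primality using (euclidsLemma; prime⇒nonZero; ¬prime[1])
import Data.Nat.Coprimality as Coprime
open import Data.Integer as ℤ using (-[1+_])
import Data.Integer.Properties as ℤP
import Data.Integer.Divisibility.Signed as ℤD
import Data.Rational as ℚ
open import Data.Rational using (_/_; mkℚ)
import Data.Rational.Properties as ℚP
open import Data.Product using (_,_; _×_; ∃-syntax; proj₁; proj₂)
open import Data.Sum using (_⊎_; inj₁; inj₂)
open import Data.Empty using (⊥-elim)
open import Relation.Nullary using (yes; no)
open import Relation.Binary.PropositionalEquality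
open import Data.Integer.Tactic.RingSolver using (solve-∀)
import Data.Nat.Tactic.RingSolver as ℕSolver

-- The embedding i ↦ i / 1 of ℤ into ℚ preserves + and *: an integer over 1
-- is already in lowest terms, so i / 1 is the normal form mkℚ i 0.
/1-normal : ∀ i → i / 1 ≡ mkℚ i 0 (Coprime.sym (Coprime.1-coprimeTo ∣ i ∣))
/1-normal (+ n)    = ℚP.normalize-coprime (Coprime.sym (Coprime.1-coprimeTo n))
/1-normal -[1+ n ] = cong ℚ.-_ (ℚP.normalize-coprime (Coprime.sym (Coprime.1-coprimeTo (suc n))))

/1-+ : ∀ i j → i / 1 ℚ.+ j / 1 ≡ (i ℤ.+ j) / 1
/1-+ i j rewrite /1-normal i | /1-normal j = ℚP./-cong (over-1 i j) refl
  where
  over-1 : ∀ i j → i ℤ.* + 1 ℤ.+ j ℤ.* + 1 ≡ i ℤ.+ j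
  over-1 = solve-∀

/1-* : ∀ i j → (i / 1) ℚ.* (j / 1) ≡ (i ℤ.* j) / 1
/1-* i j rewrite /1-normal i | /1-normal j = refl

-- An integer root r of X² + bX + c yields the factorisation
-- (X − r)(X + (r + b)) over ℚ, so an irreducible quadratic has no such root.
irreducible⇒no-root : ∀ b c → IrreducibleQuad b c → ∀ r → quadEval b c r ≢ + 0
irreducible⇒no-root b c irreducible r root =
  irreducible (ℚ.1ℚ , (ℤ.- r) / 1 , ℚ.1ℚ , (r ℤ.+ b) / 1
              , (λ ()) , (λ ()) , refl , linear-coefficient , constant-coefficient)
  where
  open ≡-Reasoning

  linear-coefficient : ℚ.1ℚ ℚ.* ((r ℤ.+ b) / 1) ℚ.+ ((ℤ.- r) / 1) ℚ.* ℚ.1ℚ ≡ b / 1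
  linear-coefficient = begin
    ℚ.1ℚ ℚ.* ((r ℤ.+ b) / 1) ℚ.+ ((ℤ.- r) / 1) ℚ.* ℚ.1ℚ
      ≡⟨ cong₂ ℚ._+_ (ℚP.*-identityˡ ((r ℤ.+ b) / 1)) (ℚP.*-identityʳ ((ℤ.- r) / 1)) ⟩
    (r ℤ.+ b) / 1 ℚ.+ (ℤ.- r) / 1
      ≡⟨ /1-+ (r ℤ.+ b) (ℤ.- r) ⟩
    (r ℤ.+ b ℤ.- r) / 1
      ≡⟨ cong (_/ 1) (cancel r b) ⟩
    b / 1 ∎
    where
    cancel : ∀ r b → r ℤ.+ b ℤ.- r ≡ b
    cancel = solve-∀

  constant-coefficient : ((ℤ.- r) / 1) ℚ.* ((r ℤ.+ b) / 1) ≡ c / 1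
  constant-coefficient = begin
    ((ℤ.- r) / 1) ℚ.* ((r ℤ.+ b) / 1) ≡⟨ /1-* (ℤ.- r) (r ℤ.+ b) ⟩
    (ℤ.- r ℤ.* (r ℤ.+ b)) / 1         ≡⟨ cong (_/ 1) (product r b c) ⟩
    (c ℤ.- quadEval b c r) / 1        ≡⟨ cong (λ v → (c ℤ.- v) / 1) root ⟩
    (c ℤ.- + 0) / 1                   ≡⟨ cong (_/ 1) (ℤP.+-identityʳ c) ⟩
    c / 1 ∎
    where
    product : ∀ r b c → ℤ.- r ℤ.* (r ℤ.+ b) ≡ c ℤ.- (r ℤ.* r ℤ.+ b ℤ.* r ℤ.+ c)
    product = solve-∀

∏[1…_] : ℕ → (ℕ → ℕ) → ℕ
∏[1… zero  ] g = 1
∏[1… suc x ] g = ∏[1… x ] g * g (suc x)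

∣quadProd∣ : ∀ b c x → ∣ quadProd b c x ∣ ≡ ∏[1… x ] (λ n → ∣ quadEval b c (+ n) ∣)
∣quadProd∣ b c zero    = refl
∣quadProd∣ b c (suc x) = begin
  ∣ quadProd b c x ℤ.* quadEval b c (+ suc x) ∣
    ≡⟨ ℤP.abs-* (quadProd b c x) (quadEval b c (+ suc x)) ⟩
  ∣ quadProd b c x ∣ * ∣ quadEval b c (+ suc x) ∣
    ≡⟨ cong (_* ∣ quadEval b c (+ suc x) ∣) (∣quadProd∣ b c x) ⟩
  ∏[1… x ] (λ n → ∣ quadEval b c (+ n) ∣) * ∣ quadEval b c (+ suc x) ∣ ∎
  where open ≡-Reasoning

prime∣∏ : ∀ {p} → Prime p → ∀ g x → p ℕD.∣ ∏[1… x ] g →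
          ∃[ n ] (1 ≤ n × n ≤ x × p ℕD.∣ g n)
prime∣∏ prime g zero    p∣1 = ⊥-elim (¬prime[1] (subst Prime (ℕD.∣1⇒≡1 p∣1) prime))
prime∣∏ prime g (suc x) p∣∏ with euclidsLemma (∏[1… x ] g) (g (suc x)) prime p∣∏
... | inj₂ p∣last = suc x , s≤s z≤n , ℕP.≤-refl , p∣last
... | inj₁ p∣init with prime∣∏ prime g x p∣init
...   | n , 1≤n , n≤x , p∣gn = n , 1≤n , ℕP.m≤n⇒m≤1+n n≤x , p∣gn

-- If p | a and p² | ab for a prime p, then either p² | a or p | b:
-- write a = kp; then p | kb, so p | k or p | b.
prime²∣*-left : ∀ {p a b} → Prime p → p ℕD.∣ a → p * p ℕD.∣ a * b →
                p * p ℕD.∣ a ⊎ p ℕD.∣ b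
prime²∣*-left {p} {a} {b} prime (ℕD.divides k a≡kp) p²∣ab
  with euclidsLemma k b prime p∣kb
  where
  instance _ = prime⇒nonZero prime
  regroup : ∀ k p b → k * p * b ≡ p * (k * b)
  regroup = ℕSolver.solve-∀
  p∣kb : p ℕD.∣ k * b
  p∣kb = ℕD.*-cancelˡ-∣ p (subst (p * p ℕD.∣_) (trans (cong (_* b) a≡kp) (regroup k p b)) p²∣ab)
... | inj₁ p∣k = inj₁ (subst (p * p ℕD.∣_) (sym a≡kp) (ℕD.*-monoˡ-∣ p p∣k))
... | inj₂ p∣b = inj₂ p∣b

prime²∣* : ∀ {p} a b → Prime p → p * p ℕD.∣ a * b →
           p * p ℕD.∣ a ⊎ p * p ℕD.∣ b ⊎ (p ℕD.∣ a × p ℕD.∣ b)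
prime²∣* {p} a b prime p²∣ab with euclidsLemma a b prime (ℕD.∣-trans (ℕD.m∣m*n p) p²∣ab)
... | inj₁ p∣a with prime²∣*-left prime p∣a p²∣ab
...   | inj₁ p²∣a = inj₁ p²∣a
...   | inj₂ p∣b  = inj₂ (inj₂ (p∣a , p∣b))
prime²∣* {p} a b prime p²∣ab | inj₂ p∣b
  with prime²∣*-left prime p∣b (subst (p * p ℕD.∣_) (ℕP.*-comm a b) p²∣ab)
...   | inj₁ p²∣b = inj₂ (inj₁ p²∣b)
...   | inj₂ p∣a  = inj₂ (inj₂ (p∣a , p∣b))

prime²∣∏ : ∀ {p} → Prime p → ∀ g x → p * p ℕD.∣ ∏[1… x ] g →
           (∃[ n ] (1 ≤ n × n ≤ x × p * p ℕD.∣ g n)) ⊎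
           (∃[ n ] ∃[ m ] (1 ≤ n × n < m × m ≤ x × p ℕD.∣ g n × p ℕD.∣ g m))
prime²∣∏ prime g zero p²∣1 =
  ⊥-elim (¬prime[1] (subst Prime (ℕD.∣1⇒≡1 (ℕD.∣-trans (ℕD.m∣m*n _) p²∣1)) prime))
prime²∣∏ prime g (suc x) p²∣∏ with prime²∣* (∏[1… x ] g) (g (suc x)) prime p²∣∏
... | inj₂ (inj₁ p²∣last) = inj₁ (suc x , s≤s z≤n , ℕP.≤-refl , p²∣last)
... | inj₂ (inj₂ (p∣init , p∣last)) with prime∣∏ prime g x p∣init
...   | n , 1≤n , n≤x , p∣gn = inj₂ (n , suc x , 1≤n , s≤s n≤x , ℕP.≤-refl , p∣gn , p∣last)
prime²∣∏ prime g (suc x) p²∣∏ | inj₁ p²∣init with prime²∣∏ prime g x p²∣init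
...   | inj₁ (n , 1≤n , n≤x , p²∣gn) = inj₁ (n , 1≤n , ℕP.m≤n⇒m≤1+n n≤x , p²∣gn)
...   | inj₂ (n , m , 1≤n , n<m , m≤x , p∣gn , p∣gm) =
          inj₂ (n , m , 1≤n , n<m , ℕP.m≤n⇒m≤1+n m≤x , p∣gn , p∣gm)

∣⇒≤ : ∀ {m n} → m ℕD.∣ n → n ≢ 0 → m ≤ n
∣⇒≤ m∣n n≢0 = ℕD.∣⇒≤ {{ℕ.≢-nonZero n≢0}} m∣n

square-<⇒< : ∀ {m n} → m * m < n * n → m < n
square-<⇒< {m} {n} m²<n² with m ℕP.<? n
... | yes m<n = m<n
... | no m≮n  = ⊥-elim (ℕP.<⇒≱ m²<n² (ℕP.*-mono-≤ (ℕP.≮⇒≥ m≮n) (ℕP.≮⇒≥ m≮n)))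

∣quadEval∣≤ : ∀ b c n → ∣ quadEval b c (+ n) ∣ ≤ n * n + ∣ b ∣ * n + ∣ c ∣
∣quadEval∣≤ b c n = begin
  ∣ + n ℤ.* + n ℤ.+ b ℤ.* + n ℤ.+ c ∣       ≤⟨ ℤP.∣i+j∣≤∣i∣+∣j∣ (+ n ℤ.* + n ℤ.+ b ℤ.* + n) c ⟩
  ∣ + n ℤ.* + n ℤ.+ b ℤ.* + n ∣ + ∣ c ∣     ≤⟨ ℕP.+-monoˡ-≤ ∣ c ∣ (ℤP.∣i+j∣≤∣i∣+∣j∣ (+ n ℤ.* + n) (b ℤ.* + n)) ⟩
  ∣ + n ℤ.* + n ∣ + ∣ b ℤ.* + n ∣ + ∣ c ∣   ≡⟨ cong₂ (λ u v → u + v + ∣ c ∣) (ℤP.abs-* (+ n) (+ n)) (ℤP.abs-* b (+ n)) ⟩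
  n * n + ∣ b ∣ * n + ∣ c ∣                 ∎
  where open ℕP.≤-Reasoning

module BoundEstimates (K C : ℕ) {x : ℕ} (x≥1 : 1 ≤ x) where
  B : ℕ
  B = (2 + K + C) * x

  private
    instance _ = ℕ.>-nonZero x≥1

    expansion : ∀ K C x → (2 + K + C) * x ≡ x + x + K * x + C * x
    expansion = ℕSolver.solve-∀

  x<B : x < B
  x<B = begin-strict
    x                     <⟨ ℕP.m<m+n x x≥1 ⟩
    x + x                 ≤⟨ ℕP.m≤m+n (x + x) (K * x) ⟩
    x + x + K * x         ≤⟨ ℕP.m≤m+n (x + x + K * x) (C * x) ⟩
    x + x + K * x + C * x ≡⟨ expansion K C x ⟨
    B                     ∎
    where open ℕP.≤-Reasoning

  linear<B : 1 ≤ C → x + x + K < B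
  linear<B C≥1 = begin-strict
    x + x + K             ≤⟨ ℕP.+-monoʳ-≤ (x + x) (ℕP.m≤m*n K x) ⟩
    x + x + K * x         <⟨ ℕP.m<m+n (x + x + K * x) (ℕP.*-mono-≤ C≥1 x≥1) ⟩
    x + x + K * x + C * x ≡⟨ expansion K C x ⟨
    B                     ∎
    where open ℕP.≤-Reasoning

  -- Used when m + n + b = 0, so that f(n) = c − nm.
  constant+xK<B : C + x * K < B
  constant+xK<B = begin-strict
    C + x * K             ≤⟨ ℕP.+-mono-≤ (ℕP.m≤m*n C x) (ℕP.≤-reflexive (ℕP.*-comm x K)) ⟩
    C * x + K * x         <⟨ ℕP.m<n+m (C * x + K * x) (ℕP.≤-trans x≥1 (ℕP.m≤m+n x x)) ⟩
    x + x + (C * x + K * x) ≡⟨ regroup K C x ⟩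
    B                     ∎
    where
    open ℕP.≤-Reasoning
    regroup : ∀ K C x → x + x + (C * x + K * x) ≡ (2 + K + C) * x
    regroup = ℕSolver.solve-∀

  quadratic<B² : x * x + K * x + C < B * B
  quadratic<B² = begin-strict
    x * x + K * x + C         ≤⟨ ℕP.+-mono-≤ (ℕP.+-monoʳ-≤ (x * x) (ℕP.m≤m*n (K * x) x))
                                             (ℕP.≤-trans (ℕP.m≤m*n C x) (ℕP.m≤m*n (C * x) x)) ⟩
    x * x + K * x * x + C * x * x <⟨ ℕP.m<n+m _ (ℕP.*-mono-≤ x≥1 x≥1) ⟩
    x * x + (x * x + K * x * x + C * x * x) ≡⟨ regroup K C x ⟩
    B * x                     ≤⟨ ℕP.*-monoʳ-≤ B (ℕP.<⇒≤ x<B) ⟩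
    B * B                     ∎
    where
    open ℕP.≤-Reasoning
    regroup : ∀ K C x → x * x + (x * x + K * x * x + C * x * x) ≡ (2 + K + C) * x * x
    regroup = ℕSolver.solve-∀

∣quadEval-difference : ∀ b c {p n m} → n ≤ m →
  p ℕD.∣ ∣ quadEval b c (+ n) ∣ → p ℕD.∣ ∣ quadEval b c (+ m) ∣ →
  p ℕD.∣ (m ∸ n) * ∣ + m ℤ.+ + n ℤ.+ b ∣
∣quadEval-difference b c {p} {n} {m} n≤m p∣fn p∣fm =
  subst (p ℕD.∣_) ∣factorisation∣ (ℤD.∣⇒∣ᵤ (subst (+ p ℤD.∣_) (difference (+ m) (+ n) b c) p∣fm-fn))
  where
  W : ℤ
  W = + m ℤ.+ + n ℤ.+ b

  difference : ∀ m n b c → (m ℤ.* m ℤ.+ b ℤ.* m ℤ.+ c) ℤ.- (n ℤ.* n ℤ.+ b ℤ.* n ℤ.+ c)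
                          ≡ (m ℤ.- n) ℤ.* (m ℤ.+ n ℤ.+ b)
  difference = solve-∀

  p∣fm-fn : + p ℤD.∣ quadEval b c (+ m) ℤ.- quadEval b c (+ n)
  p∣fm-fn = ℤD.∣m∣n⇒∣m-n (ℤD.∣ᵤ⇒∣ {+ p} {quadEval b c (+ m)} p∣fm)
                         (ℤD.∣ᵤ⇒∣ {+ p} {quadEval b c (+ n)} p∣fn)

  ∣factorisation∣ : ∣ (+ m ℤ.- + n) ℤ.* W ∣ ≡ (m ∸ n) * ∣ W ∣
  ∣factorisation∣ = trans (ℤP.abs-* (+ m ℤ.- + n) W)
    (cong (λ d → ∣ d ∣ * ∣ W ∣) (trans (ℤP.m-n≡m⊖n m n) (ℤP.⊖-≥ n≤m)))

vanishing-linear-factor : ∀ b c m n → + m ℤ.+ + n ℤ.+ b ≡ + 0 →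
  ∣ b ∣ ≡ m + n × quadEval b c (+ n) ≡ c ℤ.- + n ℤ.* + m
vanishing-linear-factor b c m n W≡0 =
  trans (cong ∣_∣ b≡-[m+n]) (ℤP.∣-i∣≡∣i∣ (+ (m + n))) ,
  trans (cong (λ b → quadEval b c (+ n)) b≡-[m+n]) (value (+ m) (+ n) c)
  where
  open ≡-Reasoning

  split : ∀ m n b → b ≡ (m ℤ.+ n ℤ.+ b) ℤ.- (m ℤ.+ n)
  split = solve-∀

  value : ∀ m n c → n ℤ.* n ℤ.+ ℤ.- (m ℤ.+ n) ℤ.* n ℤ.+ c ≡ c ℤ.- n ℤ.* m
  value = solve-∀

  b≡-[m+n] : b ≡ ℤ.- (+ m ℤ.+ + n)
  b≡-[m+n] = begin
    b                                 ≡⟨ split (+ m) (+ n) b ⟩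
    (+ m ℤ.+ + n ℤ.+ b) ℤ.- (+ m ℤ.+ + n) ≡⟨ cong (ℤ._- (+ m ℤ.+ + n)) W≡0 ⟩
    + 0 ℤ.- (+ m ℤ.+ + n)             ≡⟨ ℤP.+-identityˡ (ℤ.- (+ m ℤ.+ + n)) ⟩
    ℤ.- (+ m ℤ.+ + n)                 ∎

module Cases (b c : ℤ) (no-root : ∀ r → quadEval b c r ≢ + 0) {x : ℕ} (x≥1 : 1 ≤ x) where
  open BoundEstimates ∣ b ∣ ∣ c ∣ x≥1

  ∣quadEval∣≢0 : ∀ n → ∣ quadEval b c (+ n) ∣ ≢ 0
  ∣quadEval∣≢0 n ∣fn∣≡0 = no-root (+ n) (ℤP.∣i∣≡0⇒i≡0 ∣fn∣≡0)

  -- c = f(0) ≠ 0.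
  ∣c∣≥1 : 1 ≤ ∣ c ∣
  ∣c∣≥1 = ℕP.n≢0⇒n>0 (λ ∣c∣≡0 → ∣quadEval∣≢0 0 (trans (cong ∣_∣ (value-at-0 b c)) ∣c∣≡0))
    where
    value-at-0 : ∀ b c → + 0 ℤ.* + 0 ℤ.+ b ℤ.* + 0 ℤ.+ c ≡ c
    value-at-0 = solve-∀

  square-case : ∀ {p n} → n ≤ x → p * p ℕD.∣ ∣ quadEval b c (+ n) ∣ → p < B
  square-case {p} {n} n≤x p²∣fn = square-<⇒< (begin-strict
    p * p                         ≤⟨ ∣⇒≤ p²∣fn (∣quadEval∣≢0 n) ⟩
    ∣ quadEval b c (+ n) ∣        ≤⟨ ∣quadEval∣≤ b c n ⟩
    n * n + ∣ b ∣ * n + ∣ c ∣     ≤⟨ ℕP.+-monoˡ-≤ ∣ c ∣ (ℕP.+-mono-≤ (ℕP.*-mono-≤ n≤x n≤x)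
                                                                   (ℕP.*-monoʳ-≤ ∣ b ∣ n≤x)) ⟩
    x * x + ∣ b ∣ * x + ∣ c ∣     <⟨ quadratic<B² ⟩
    B * B ∎)
    where open ℕP.≤-Reasoning

  two-values-case : ∀ {p n m} → Prime p → n < m → m ≤ x →
    p ℕD.∣ ∣ quadEval b c (+ n) ∣ → p ℕD.∣ ∣ quadEval b c (+ m) ∣ → p < B
  two-values-case {p} {n} {m} prime n<m m≤x p∣fn p∣fm
    with euclidsLemma (m ∸ n) ∣ + m ℤ.+ + n ℤ.+ b ∣ prime
                      (∣quadEval-difference b c (ℕP.<⇒≤ n<m) p∣fn p∣fm)
  ... | inj₁ p∣m-n = begin-strict
    p     ≤⟨ ∣⇒≤ p∣m-n (ℕP.m>n⇒m∸n≢0 n<m) ⟩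
    m ∸ n ≤⟨ ℕP.m∸n≤m m n ⟩
    m     ≤⟨ m≤x ⟩
    x     <⟨ x<B ⟩
    B     ∎
    where open ℕP.≤-Reasoning
  ... | inj₂ p∣W with ∣ + m ℤ.+ + n ℤ.+ b ∣ ℕP.≟ 0
  ...   | no ∣W∣≢0 = begin-strict
    p                           ≤⟨ ∣⇒≤ p∣W ∣W∣≢0 ⟩
    ∣ + m ℤ.+ + n ℤ.+ b ∣       ≤⟨ ℤP.∣i+j∣≤∣i∣+∣j∣ (+ m ℤ.+ + n) b ⟩
    m + n + ∣ b ∣               ≤⟨ ℕP.+-monoˡ-≤ ∣ b ∣ (ℕP.+-mono-≤ m≤x (ℕP.≤-trans (ℕP.<⇒≤ n<m) m≤x)) ⟩
    x + x + ∣ b ∣               <⟨ linear<B ∣c∣≥1 ⟩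
    B ∎
    where open ℕP.≤-Reasoning
  ...   | yes ∣W∣≡0 = begin-strict
    p                           ≤⟨ ∣⇒≤ p∣fn (∣quadEval∣≢0 n) ⟩
    ∣ quadEval b c (+ n) ∣      ≡⟨ cong ∣_∣ fn≡c-nm ⟩
    ∣ c ℤ.- + n ℤ.* + m ∣       ≤⟨ ℤP.∣i-j∣≤∣i∣+∣j∣ c (+ n ℤ.* + m) ⟩
    ∣ c ∣ + ∣ + n ℤ.* + m ∣     ≡⟨ cong (λ k → ∣ c ∣ + k) (ℤP.abs-* (+ n) (+ m)) ⟩
    ∣ c ∣ + n * m               ≤⟨ ℕP.+-monoʳ-≤ ∣ c ∣ (ℕP.*-mono-≤ n≤x m≤∣b∣) ⟩
    ∣ c ∣ + x * ∣ b ∣           <⟨ constant+xK<B ⟩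
    B ∎
    where
    open ℕP.≤-Reasoning
    n≤x : n ≤ x
    n≤x = ℕP.≤-trans (ℕP.<⇒≤ n<m) m≤x
    vanishing : ∣ b ∣ ≡ m + n × quadEval b c (+ n) ≡ c ℤ.- + n ℤ.* + m
    vanishing = vanishing-linear-factor b c m n (ℤP.∣i∣≡0⇒i≡0 ∣W∣≡0)
    fn≡c-nm : quadEval b c (+ n) ≡ c ℤ.- + n ℤ.* + m
    fn≡c-nm = proj₂ vanishing
    m≤∣b∣ : m ≤ ∣ b ∣
    m≤∣b∣ = subst (m ≤_) (sym (proj₁ vanishing)) (ℕP.m≤m+n m n)

mainTheorem8 : (b c : ℤ) → IrreducibleQuad b c →
    (x : ℕ) → 1 ≤ x → (p : ℕ) → Prime p →
    (+ (p ^ 2)) ∣ quadProd b c x →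
    p < (2 + ∣ b ∣ + ∣ c ∣) * x
mainTheorem8 b c irreducible x x≥1 p prime p²∣∏f
  with prime²∣∏ prime (λ n → ∣ quadEval b c (+ n) ∣) x p²∣∏∣f∣
  where
  p²∣∏∣f∣ : p * p ℕD.∣ ∏[1… x ] (λ n → ∣ quadEval b c (+ n) ∣)
  p²∣∏∣f∣ = subst₂ ℕD._∣_ (cong (p *_) (ℕP.*-identityʳ p)) (∣quadProd∣ b c x) p²∣∏f
... | inj₁ (n , _ , n≤x , p²∣fn) = square-case n≤x p²∣fn
  where open Cases b c (irreducible⇒no-root b c irreducible) x≥1
... | inj₂ (n , m , _ , n<m , m≤x , p∣fn , p∣fm) = two-values-case prime n<m m≤x p∣fn p∣fm
  where open Cases b c (irreducible⇒no-root b c irreducible) x≥1
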